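{- Let $\mathcal{A}=(a_n)_{n\in\mathbb{N}_+}$ be a sequence of positive integers, and let $k$ and $m$ be positive integers with $m\geqslant 2$. Then the sequence $(p_\mathcal{A}(n,k)\bmod m)_{n\in\mathbb{N}}$ is periodic, and $m^{k-1}\operatorname{lcm}\{a_1,\ldots,a_k\}$ is a period of it.
   Context: $\mathbb{N}=\{0,1,2,\ldots\}$. For $k\in\mathbb{N}_+$ and $n\in\mathbb{N}$, $p_\mathcal{A}(n,k)$ is the number of tuples $(x_1,\ldots,x_k)\in\mathbb{N}^k$ with $a_1x_1+\cdots+a_kx_k=n$, i.e. $\sum_{n\ge0}p_\mathcal{A}(n,k)x^n=\prod_{i=1}^k(1-x^{a_i})^{ -1}$. A sequence $(x_n)_{n\in\mathbb{N}}$ is periodic if there is a positive integer $s$ with $x_n=x_{n+s}$ for all sufficiently large $n$; such an $s$ is called a period. -}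

module Defs where

open import Data.Nat using (ℕ; zero; suc; _+_; _*_; _≟_)
open import Data.Nat.LCM using (lcm)
open import Data.List using (List; []; _∷_; map; concatMap; upTo; length; filter)
open import Data.Product using (_×_; _,_; Σ; ∃)
open import Relation.Binary.PropositionalEquality using (_≡_)

-- The sequence 𝒜 = (a_1, a_2, ...) is encoded as  a : ℕ → ℕ  with  a i = a_{i+1}.

boxTuples : ℕ → ℕ → List (List ℕ)
boxTuples n zero    = [] ∷ []
boxTuples n (suc k) = concatMap (λ xs → map (λ x → xs Data.List.++ (x ∷ [])) (upTo (suc n))) (boxTuples n k)

wsum : (ℕ → ℕ) → ℕ → List ℕ → ℕ
wsum a i []       = 0
wsum a i (x ∷ xs) = a i * x + wsum a (suc i) xs

-- p_𝒜(n,k): number of (x_1,...,x_k) ∈ ℕ^k with a_1x_1+...+a_kx_k = n.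
-- Since all a_i ≥ 1, every solution has x_i ≤ n, so it suffices to count in {0..n}^k.
pA : (ℕ → ℕ) → ℕ → ℕ → ℕ
pA a n k = length (filter (λ xs → wsum a 0 xs ≟ n) (boxTuples n k))

lcmUpTo : (ℕ → ℕ) → ℕ → ℕ
lcmUpTo a zero    = 1
lcmUpTo a (suc k) = lcm (lcmUpTo a k) (a k)

IsPeriod : (ℕ → ℕ) → ℕ → Set
IsPeriod x s = Data.Nat._<_ 0 s × ∃ λ N → ∀ n → Data.Nat._≤_ N n → x n ≡ x (n + s)

Periodic : (ℕ → ℕ) → Set
Periodic x = ∃ λ s → IsPeriod x s

-- Counting solutions by their last coordinate gives the recurrence
--   p(n + a_{k+1}, k+1) = p(n + a_{k+1}, k) + p(n, k+1).
-- Iterating it t times, p(n + t a_{k+1}, k+1) = p(n, k+1) + D(n), where D(n) is a sum of t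
-- values of p(·, k); so if p(·, k) mod m has period Q = t a_{k+1}, then so has D mod m, and
-- p(n + rQ, k+1) ≡ p(n, k+1) + r D(n) (mod m), which returns to p(n, k+1) at r = m.
-- Starting from the period a_1 of p(·, 1), each step multiplies the period by m and
-- enlarges it to a common multiple of the next weight.
module Submission where

open import Defs
open import Data.Nat using (ℕ; _<_; _≤_; _^_; _*_; _∸_; _%_; NonZero)
open import Data.Product using (_×_)

open import Data.Nat using (zero; suc; _+_; _≟_; z≤n; s≤s; >-nonZero)
open import Data.Nat.Properties
open import Data.Nat.DivMod using (%-distribˡ-+; [m+kn]%n≡m%n)
open import Data.Nat.Divisibility using (_∣_; divides; ∣-trans; n∣m*n; *-monoʳ-∣)
open import Data.Nat.GCD using (gcd)
open import Data.Nat.LCM using (lcm; m∣lcm[m,n]; n∣lcm[m,n]; gcd*lcm)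
open import Data.Nat.ListAction using (sum)
open import Data.Nat.ListAction.Properties using (sum-++)
open import Data.Nat.Solver using (module +-*-Solver)
open import Data.Bool using (true; false; if_then_else_)
open import Data.List using (List; []; _∷_; _++_; [_]; map; concat; concatMap; applyUpTo; upTo; length; filter)
open import Data.List.Properties using (length-++; map-cong; map-cong-local; map-∘; map-concatMap; map-upTo; map-applyUpTo)
open import Data.List.Relation.Unary.All as All using (All; []; _∷_)
open import Data.List.Relation.Unary.All.Properties using (concat⁺; map⁺; applyUpTo⁺₂)
open import Data.Product using (_,_; ∃)
open import Function using (_∘_; id)
open import Relation.Binary.PropositionalEquality using (_≡_; refl; sym; trans; cong; cong₂; subst; module ≡-Reasoning)
open import Relation.Nullary using (yes; no; does; ¬_)
open import Relation.Nullary.Decidable using (dec-true; dec-false)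

open +-*-Solver using (solve; _:+_; _:=_)

∑< : ℕ → (ℕ → ℕ) → ℕ
∑< n h = sum (applyUpTo h n)

syntax ∑< n (λ x → e) = ∑[ x < n ] e

∑<-cong : ∀ n {h h′ : ℕ → ℕ} → (∀ x → h x ≡ h′ x) → ∑< n h ≡ ∑< n h′
∑<-cong zero    h≗h′ = refl
∑<-cong (suc n) h≗h′ = cong₂ _+_ (h≗h′ 0) (∑<-cong n (h≗h′ ∘ suc))

∑<-zero : ∀ n {h : ℕ → ℕ} → (∀ x → h x ≡ 0) → ∑< n h ≡ 0
∑<-zero zero    h≡0 = refl
∑<-zero (suc n) h≡0 = cong₂ _+_ (h≡0 0) (∑<-zero n (h≡0 ∘ suc))

∑<-pad : ∀ {n N} {h : ℕ → ℕ} → (∀ x → n ≤ x → h x ≡ 0) → n ≤ N → ∑< N h ≡ ∑< n h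
∑<-pad {N = N} h≡0 z≤n       = ∑<-zero N (λ x → h≡0 x z≤n)
∑<-pad {h = h} h≡0 (s≤s n≤N) = cong (h 0 +_) (∑<-pad (λ x → h≡0 (suc x) ∘ s≤s) n≤N)

sum-concat : ∀ (xss : List (List ℕ)) → sum (concat xss) ≡ sum (map sum xss)
sum-concat []         = refl
sum-concat (xs ∷ xss) = trans (sum-++ xs (concat xss)) (cong (sum xs +_) (sum-concat xss))

sum-map-+ : ∀ {A : Set} (f g : A → ℕ) xs → sum (map (λ x → f x + g x) xs) ≡ sum (map f xs) + sum (map g xs)
sum-map-+ f g []       = refl
sum-map-+ f g (x ∷ xs) = trans (cong (f x + g x +_) (sum-map-+ f g xs)) (+-+-comm (f x) (g x) _ _)
  where
  +-+-comm : ∀ a b c d → a + b + (c + d) ≡ a + c + (b + d)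
  +-+-comm = solve 4 (λ a b c d → a :+ b :+ (c :+ d) := a :+ c :+ (b :+ d)) refl

δ : ℕ → ℕ → ℕ
δ n w = if does (w ≟ n) then 1 else 0

δ-≢ : ∀ {n w} → ¬ w ≡ n → δ n w ≡ 0
δ-≢ {n} {w} w≢n = cong (if_then 1 else 0) (dec-false (w ≟ n) w≢n)

δ-refl : ∀ n → δ n n ≡ 1
δ-refl n = cong (if_then 1 else 0) (dec-true (n ≟ n) refl)

δ-+ : ∀ n A w → δ (n + A) (w + A) ≡ δ n w
δ-+ n A w with w ≟ n
... | yes refl = trans (δ-refl (n + A)) (sym (δ-refl n))
... | no w≢n   = trans (δ-≢ (w≢n ∘ +-cancelʳ-≡ A w n)) (sym (δ-≢ w≢n))

VanishesAbove : ℕ → (ℕ → ℕ) → Set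
VanishesAbove n φ = ∀ w → n < w → φ w ≡ 0

δ-vanishesAbove : ∀ n → VanishesAbove n (δ n)
δ-vanishesAbove n w n<w = δ-≢ (λ w≡n → <⇒≢ n<w (sym w≡n))

length-filter≡sum-δ : ∀ {A : Set} (f : A → ℕ) n xs →
  length (filter (λ x → f x ≟ n) xs) ≡ sum (map (λ x → δ n (f x)) xs)
length-filter≡sum-δ f n []       = refl
length-filter≡sum-δ f n (x ∷ xs) with does (f x ≟ n)
... | true  = cong suc (length-filter≡sum-δ f n xs)
... | false = length-filter≡sum-δ f n xs

boxTuples-length : ∀ B k → All (λ xs → length xs ≡ k) (boxTuples B k)
boxTuples-length B zero    = refl ∷ []
boxTuples-length B (suc k) = concat⁺ (map⁺ (All.map snoc-length (boxTuples-length B k)))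
  where
  snoc-length : ∀ {xs} → length xs ≡ k → All (λ ys → length ys ≡ suc k) (map (λ x → xs ++ [ x ]) (upTo (suc B)))
  snoc-length {xs} refl = map⁺ (applyUpTo⁺₂ id (suc B) (λ _ → trans (length-++ xs) (+-comm (length xs) 1)))

wsum-snoc : ∀ a i xs x → wsum a i (xs ++ [ x ]) ≡ wsum a i xs + a (i + length xs) * x
wsum-snoc a i []       x = trans (+-identityʳ _) (cong (λ j → a j * x) (sym (+-identityʳ i)))
wsum-snoc a i (y ∷ xs) x = begin
  a i * y + wsum a (suc i) (xs ++ [ x ])                      ≡⟨ cong (a i * y +_) (wsum-snoc a (suc i) xs x) ⟩
  a i * y + (wsum a (suc i) xs + a (suc i + length xs) * x)   ≡⟨ +-assoc (a i * y) _ _ ⟨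
  a i * y + wsum a (suc i) xs + a (suc i + length xs) * x     ≡⟨ cong (λ j → a i * y + wsum a (suc i) xs + a j * x) (+-suc i (length xs)) ⟨
  a i * y + wsum a (suc i) xs + a (i + suc (length xs)) * x   ∎
  where open ≡-Reasoning

boxSum : (ℕ → ℕ) → ℕ → ℕ → (ℕ → ℕ) → ℕ
boxSum a B k φ = sum (map (φ ∘ wsum a 0) (boxTuples B k))

lastCoordSum : (ℕ → ℕ) → ℕ → ℕ → (ℕ → ℕ) → ℕ → ℕ
lastCoordSum a B k φ w = ∑[ x < suc B ] φ (w + a k * x)

pA≡boxSum-δ : ∀ a n k → pA a n k ≡ boxSum a n k (δ n)
pA≡boxSum-δ a n k = length-filter≡sum-δ (wsum a 0) n (boxTuples n k)

boxSum-cong : ∀ a B k {φ χ : ℕ → ℕ} → (∀ w → φ w ≡ χ w) → boxSum a B k φ ≡ boxSum a B k χ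
boxSum-cong a B k φ≗χ = cong sum (map-cong (φ≗χ ∘ wsum a 0) (boxTuples B k))

boxSum-+ : ∀ a B k (φ χ : ℕ → ℕ) → boxSum a B k (λ w → φ w + χ w) ≡ boxSum a B k φ + boxSum a B k χ
boxSum-+ a B k φ χ = sum-map-+ (φ ∘ wsum a 0) (χ ∘ wsum a 0) (boxTuples B k)

boxSum-suc : ∀ a B k φ → boxSum a B (suc k) φ ≡ boxSum a B k (lastCoordSum a B k φ)
boxSum-suc a B k φ = begin
  sum (map F (concatMap extend (boxTuples B k)))          ≡⟨ cong sum (map-concatMap F extend (boxTuples B k)) ⟩
  sum (concat (map (map F ∘ extend) (boxTuples B k)))     ≡⟨ sum-concat (map (map F ∘ extend) (boxTuples B k)) ⟩
  sum (map sum (map (map F ∘ extend) (boxTuples B k)))    ≡⟨ cong sum (map-∘ (boxTuples B k)) ⟨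
  sum (map (sum ∘ map F ∘ extend) (boxTuples B k))        ≡⟨ cong sum (map-cong-local (All.map sum-extend (boxTuples-length B k))) ⟩
  boxSum a B k (lastCoordSum a B k φ)                     ∎
  where
  open ≡-Reasoning
  F : List ℕ → ℕ
  F = φ ∘ wsum a 0
  extend : List ℕ → List (List ℕ)
  extend xs = map (λ x → xs ++ [ x ]) (upTo (suc B))
  sum-extend : ∀ {xs} → length xs ≡ k → sum (map F (extend xs)) ≡ lastCoordSum a B k φ (wsum a 0 xs)
  sum-extend {xs} refl = begin
    sum (map F (map (λ x → xs ++ [ x ]) (upTo (suc B))))  ≡⟨ cong (sum ∘ map F) (map-upTo _ (suc B)) ⟩
    sum (map F (applyUpTo (λ x → xs ++ [ x ]) (suc B)))   ≡⟨ cong sum (map-applyUpTo (λ x → xs ++ [ x ]) F (suc B)) ⟩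
    ∑[ x < suc B ] F (xs ++ [ x ])                         ≡⟨ ∑<-cong (suc B) (cong φ ∘ wsum-snoc a 0 xs) ⟩
    lastCoordSum a B k φ (wsum a 0 xs)                     ∎

module _ (a : ℕ → ℕ) (a>0 : ∀ i → 0 < a i) where

  x≤w+a*x : ∀ k w x → x ≤ w + a k * x
  x≤w+a*x k w x = ≤-trans (m≤n*m x (a k) ⦃ >-nonZero (a>0 k) ⦄) (m≤n+m _ w)

  lastCoordSum-vanishesAbove : ∀ B k {n φ} → VanishesAbove n φ → VanishesAbove n (lastCoordSum a B k φ)
  lastCoordSum-vanishesAbove B k φ≡0 w n<w =
    ∑<-zero (suc B) (λ x → φ≡0 (w + a k * x) (<-≤-trans n<w (m≤m+n w _)))

  lastCoordSum-bound : ∀ k {n B φ} → VanishesAbove n φ → n ≤ B → ∀ w → lastCoordSum a B k φ w ≡ lastCoordSum a n k φ w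
  lastCoordSum-bound k φ≡0 n≤B w = ∑<-pad (λ x n<x → φ≡0 _ (<-≤-trans n<x (x≤w+a*x k w x))) (s≤s n≤B)

  -- All a_i > 0, so once φ vanishes above n, coordinates larger than n contribute nothing.
  boxSum-bound : ∀ k {n B φ} → VanishesAbove n φ → n ≤ B → boxSum a B k φ ≡ boxSum a n k φ
  boxSum-bound zero    φ≡0 n≤B = refl
  boxSum-bound (suc k) {n} {B} {φ} φ≡0 n≤B = begin
    boxSum a B (suc k) φ                 ≡⟨ boxSum-suc a B k φ ⟩
    boxSum a B k (lastCoordSum a B k φ)  ≡⟨ boxSum-bound k (lastCoordSum-vanishesAbove B k φ≡0) n≤B ⟩
    boxSum a n k (lastCoordSum a B k φ)  ≡⟨ boxSum-cong a n k (lastCoordSum-bound k φ≡0 n≤B) ⟩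
    boxSum a n k (lastCoordSum a n k φ)  ≡⟨ boxSum-suc a n k φ ⟨
    boxSum a n (suc k) φ                 ∎
    where open ≡-Reasoning

  lastCoordSum-δ-+ : ∀ k {n B} → n < B → ∀ w →
    lastCoordSum a B k (δ (n + a k)) w ≡ δ (n + a k) w + lastCoordSum a B k (δ n) w
  lastCoordSum-δ-+ k {n} {B} n<B w = cong₂ _+_ (cong (δ (n + A)) w+A*0≡w) (begin
    ∑[ x < B ] δ (n + A) (w + A * suc x)  ≡⟨ ∑<-cong B (λ x → trans (cong (δ (n + A)) (shift x)) (δ-+ n A (w + A * x))) ⟩
    ∑[ x < B ] δ n (w + A * x)            ≡⟨ ∑<-pad (λ x B≤x → δ-vanishesAbove n _ (<-≤-trans n<B (≤-trans B≤x (x≤w+a*x k w x)))) (n≤1+n B) ⟨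
    ∑[ x < suc B ] δ n (w + A * x)        ∎)
    where
    open ≡-Reasoning
    A = a k
    w+A*0≡w : w + A * 0 ≡ w
    w+A*0≡w = trans (cong (w +_) (*-zeroʳ A)) (+-identityʳ w)
    shift : ∀ x → w + A * suc x ≡ w + A * x + A
    shift x = trans (cong (w +_) (*-suc A x)) (solve 3 (λ w a b → w :+ (a :+ b) := w :+ b :+ a) refl w A (A * x))

  pA-recurrence : ∀ k n → pA a (n + a k) (suc k) ≡ pA a (n + a k) k + pA a n (suc k)
  pA-recurrence k n = begin
    pA a (n + A) (suc k)                                           ≡⟨ pA≡boxSum-δ a (n + A) (suc k) ⟩
    boxSum a (n + A) (suc k) (δ (n + A))                           ≡⟨ boxSum-suc a (n + A) k (δ (n + A)) ⟩
    boxSum a (n + A) k (lastCoordSum a (n + A) k (δ (n + A)))      ≡⟨ boxSum-cong a (n + A) k (lastCoordSum-δ-+ k (m<m+n n (a>0 k))) ⟩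
    boxSum a (n + A) k (λ w → δ (n + A) w + lastCoordSum a (n + A) k (δ n) w)
                                                                   ≡⟨ boxSum-+ a (n + A) k (δ (n + A)) (lastCoordSum a (n + A) k (δ n)) ⟩
    boxSum a (n + A) k (δ (n + A)) + boxSum a (n + A) k (lastCoordSum a (n + A) k (δ n))
                                                                   ≡⟨ cong₂ _+_ (pA≡boxSum-δ a (n + A) k) (boxSum-suc a (n + A) k (δ n)) ⟨
    pA a (n + A) k + boxSum a (n + A) (suc k) (δ n)                ≡⟨ cong (pA a (n + A) k +_) (boxSum-bound (suc k) (δ-vanishesAbove n) (m≤m+n n A)) ⟩
    pA a (n + A) k + boxSum a n (suc k) (δ n)                      ≡⟨ cong (pA a (n + A) k +_) (pA≡boxSum-δ a n (suc k)) ⟨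
    pA a (n + A) k + pA a n (suc k)                                ∎
    where
    open ≡-Reasoning
    A = a k

  pA-zero : ∀ {n} → 0 < n → pA a n 0 ≡ 0
  pA-zero {suc n} _ = refl

  pA-1-periodic : ∀ n → pA a (n + a 0) 1 ≡ pA a n 1
  pA-1-periodic n = trans (pA-recurrence 0 n) (cong (_+ pA a n 1) (pA-zero (<-≤-trans (a>0 0) (m≤n+m (a 0) n))))

PeriodicFrom : {A : Set} → ℕ → (ℕ → A) → ℕ → Set
PeriodicFrom N x s = ∀ n → N ≤ n → x n ≡ x (n + s)

EventuallyPeriodic : {A : Set} → (ℕ → A) → ℕ → Set
EventuallyPeriodic x s = ∃ λ N → PeriodicFrom N x s

periodicFrom-* : ∀ {A : Set} {N s} {x : ℕ → A} → PeriodicFrom N x s → ∀ r → PeriodicFrom N x (r * s)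
periodicFrom-* {s = s} {x} per zero    n N≤n = cong x (sym (+-identityʳ n))
periodicFrom-* {s = s} {x} per (suc r) n N≤n = begin
  x n                ≡⟨ periodicFrom-* per r n N≤n ⟩
  x (n + r * s)      ≡⟨ per (n + r * s) (≤-trans N≤n (m≤m+n n _)) ⟩
  x (n + r * s + s)  ≡⟨ cong x (solve 3 (λ n a b → n :+ b :+ a := n :+ (a :+ b)) refl n s (r * s)) ⟩
  x (n + suc r * s)  ∎
  where open ≡-Reasoning

eventuallyPeriodic-∣ : ∀ {A : Set} {s t} {x : ℕ → A} → EventuallyPeriodic x s → s ∣ t → EventuallyPeriodic x t
eventuallyPeriodic-∣ (N , per) (divides r refl) = N , periodicFrom-* per r

module _ (m : ℕ) .⦃ _ : NonZero m ⦄ where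

  +-cong-% : ∀ {x x′ y y′} → x % m ≡ x′ % m → y % m ≡ y′ % m → (x + y) % m ≡ (x′ + y′) % m
  +-cong-% {x} {x′} {y} {y′} x≡x′ y≡y′ = begin
    (x + y) % m              ≡⟨ %-distribˡ-+ x y m ⟩
    (x % m + y % m) % m      ≡⟨ cong₂ (λ u v → (u + v) % m) x≡x′ y≡y′ ⟩
    (x′ % m + y′ % m) % m    ≡⟨ %-distribˡ-+ x′ y′ m ⟨
    (x′ + y′) % m            ∎
    where open ≡-Reasoning

  ∑<-cong-% : ∀ n {h h′ : ℕ → ℕ} → (∀ x → h x % m ≡ h′ x % m) → ∑< n h % m ≡ ∑< n h′ % m
  ∑<-cong-% zero    h≡h′ = refl
  ∑<-cong-% (suc n) h≡h′ = +-cong-% (h≡h′ 0) (∑<-cong-% n (h≡h′ ∘ suc))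

  -- By induction g (n + r Q) ≡ g n + r · d n (mod m), and r = m kills the increment.
  periodicFrom-increment : ∀ {g d : ℕ → ℕ} {N Q} → (∀ n → g (n + Q) ≡ g n + d n) →
    PeriodicFrom N (λ n → d n % m) Q → PeriodicFrom N (λ n → g n % m) (m * Q)
  periodicFrom-increment {g} {d} {N} {Q} g-step d-per n N≤n = begin
    g n % m                  ≡⟨ [m+kn]%n≡m%n (g n) (d n) m ⟨
    (g n + d n * m) % m      ≡⟨ cong (λ e → (g n + e) % m) (*-comm (d n) m) ⟩
    (g n + m * d n) % m      ≡⟨ iterate m ⟨
    g (n + m * Q) % m        ∎
    where
    open ≡-Reasoning
    iterate : ∀ r → g (n + r * Q) % m ≡ (g n + r * d n) % m
    iterate zero    = cong (_% m) (trans (cong g (+-identityʳ n)) (sym (+-identityʳ (g n))))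
    iterate (suc r) = begin
      g (n + (Q + r * Q)) % m            ≡⟨ cong (λ e → g e % m) (solve 3 (λ n a b → n :+ (a :+ b) := n :+ b :+ a) refl n Q (r * Q)) ⟩
      g (n + r * Q + Q) % m              ≡⟨ cong (_% m) (g-step (n + r * Q)) ⟩
      (g (n + r * Q) + d (n + r * Q)) % m ≡⟨ +-cong-% (iterate r) (sym (periodicFrom-* d-per r n N≤n)) ⟩
      (g n + r * d n + d n) % m          ≡⟨ cong (_% m) (solve 3 (λ x y z → x :+ y :+ z := x :+ (z :+ y)) refl (g n) (r * d n) (d n)) ⟩
      (g n + (d n + r * d n)) % m        ∎

  periodicFrom-partialSums : ∀ {f g : ℕ → ℕ} {N A Q} → (∀ n → g (n + A) ≡ f (n + A) + g n) → A ∣ Q →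
    PeriodicFrom N (λ n → f n % m) Q → PeriodicFrom N (λ n → g n % m) (m * Q)
  periodicFrom-partialSums {f} {g} {N} {A} {Q} g-step (divides t refl) f-per =
    periodicFrom-increment (g-telescope t) partialSum-per
    where
    partialSum : ℕ → ℕ → ℕ
    partialSum t n = ∑[ j < t ] f (n + suc j * A)

    g-telescope : ∀ t n → g (n + t * A) ≡ g n + partialSum t n
    g-telescope zero    n = trans (cong g (+-identityʳ n)) (sym (+-identityʳ (g n)))
    g-telescope (suc t) n = begin
      g (n + (A + t * A))                 ≡⟨ cong g (+-assoc n A (t * A)) ⟨
      g (n + A + t * A)                   ≡⟨ g-telescope t (n + A) ⟩
      g (n + A) + partialSum t (n + A)    ≡⟨ cong₂ _+_ (g-step n) (∑<-cong t (λ j → cong f (+-assoc n A _))) ⟩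
      f (n + A) + g n + ∑[ j < t ] f (n + suc (suc j) * A)
                                          ≡⟨ solve 3 (λ x y z → x :+ y :+ z := y :+ (x :+ z)) refl (f (n + A)) (g n) _ ⟩
      g n + (f (n + A) + ∑[ j < t ] f (n + suc (suc j) * A))
                                          ≡⟨ cong (λ e → g n + (f (n + e) + ∑[ j < t ] f (n + suc (suc j) * A))) (+-identityʳ A) ⟨
      g n + partialSum (suc t) n          ∎
      where open ≡-Reasoning

    partialSum-per : PeriodicFrom N (λ n → partialSum t n % m) (t * A)
    partialSum-per n N≤n = ∑<-cong-% t λ j →
      trans (f-per (n + suc j * A) (≤-trans N≤n (m≤m+n n _)))
            (cong (λ e → f e % m) (solve 3 (λ n a b → n :+ a :+ b := n :+ b :+ a) refl n (suc j * A) (t * A)))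

lcm-pos : ∀ {x y} → 0 < x → 0 < y → 0 < lcm x y
lcm-pos {x} {y} x>0 y>0 = n≢0⇒n>0 λ lcm≡0 → <⇒≢ (*-mono-< x>0 y>0) (sym (begin
  x * y                ≡⟨ gcd*lcm x y ⟨
  gcd x y * lcm x y    ≡⟨ cong (gcd x y *_) lcm≡0 ⟩
  gcd x y * 0          ≡⟨ *-zeroʳ (gcd x y) ⟩
  0                    ∎))
  where open ≡-Reasoning

lcmUpTo-pos : ∀ a → (∀ i → 0 < a i) → ∀ k → 0 < lcmUpTo a k
lcmUpTo-pos a a>0 zero    = s≤s z≤n
lcmUpTo-pos a a>0 (suc k) = lcm-pos (lcmUpTo-pos a a>0 k) (a>0 k)

pA-eventuallyPeriodic : ∀ a → (∀ i → 0 < a i) → ∀ m .⦃ _ : NonZero m ⦄ j →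
  EventuallyPeriodic (λ n → pA a n (suc j) % m) (m ^ j * lcmUpTo a (suc j))
pA-eventuallyPeriodic a a>0 m zero =
  eventuallyPeriodic-∣ (0 , λ n _ → cong (_% m) (sym (pA-1-periodic a a>0 n)))
                       (∣-trans (n∣lcm[m,n] 1 (a 0)) (n∣m*n 1))
pA-eventuallyPeriodic a a>0 m (suc j) =
  step (eventuallyPeriodic-∣ (pA-eventuallyPeriodic a a>0 m j) (*-monoʳ-∣ (m ^ j) (m∣lcm[m,n] L A)))
  where
  L = lcmUpTo a (suc j)
  A = a (suc j)
  step : EventuallyPeriodic (λ n → pA a n (suc j) % m) (m ^ j * lcm L A) →
         EventuallyPeriodic (λ n → pA a n (suc (suc j)) % m) (m ^ suc j * lcm L A)
  step (N , per) = N , subst (PeriodicFrom N _) (sym (*-assoc m (m ^ j) _))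
    (periodicFrom-partialSums m (pA-recurrence a a>0 (suc j)) (∣-trans (n∣lcm[m,n] L A) (n∣m*n (m ^ j))) per)

corollary3p5 : (a : ℕ → ℕ) → (∀ i → 0 < a i) → (k m : ℕ) → 1 ≤ k → 2 ≤ m → .⦃ _ : NonZero m ⦄ →
    Periodic (λ n → pA a n k % m) × IsPeriod (λ n → pA a n k % m) (m ^ (k ∸ 1) * lcmUpTo a k)
corollary3p5 a a>0 (suc j) m _ _ = (_ , isPeriod) , isPeriod
  where
  isPeriod : IsPeriod (λ n → pA a n (suc j) % m) (m ^ j * lcmUpTo a (suc j))
  isPeriod = *-mono-< (m^n>0 m j) (lcmUpTo-pos a a>0 (suc j)) , pA-eventuallyPeriodic a a>0 m j
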